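{- Let $n$ be a positive integer. Suppose there exists a subset $V$ of the $\mathbb{Z}_2$-vector space of subgraphs of $K_n$ which is useful for triangles. Then every triangle-agreeing family of subgraphs of $K_n$ has size at most $2^{\binom{n}{2}-3}$.
   Context: Subgraphs of $K_n$ (on a fixed vertex set, identified with their edge sets) form a vector space over $\mathbb{Z}_2$ under symmetric difference $G_1\triangle G_2$. The agreement of $G_1,G_2$ is $(G_1\cap G_2)\cup(\overline{G_1}\cap\overline{G_2})$, where complements are with respect to $K_n$. A subset $V$ of size $2^m$ (with $m\ge 3$ an integer) is useful for triangles if every subset $S\subseteq V$ of size $2^{m-3}+1$ contains two distinct vectors whose agreement is triangle-free. A family $\mathcal{F}$ of subgraphs of $K_n$ is triangle-agreeing if the agreement of any two graphs in $\mathcal{F}$ contains a triangle. -}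

module Defs where

open import Data.Nat using (ℕ; zero; suc; _+_; _∸_; _^_; _≤_)
open import Data.Nat.Combinatorics using (_C_)
open import Data.Fin using (Fin; _<_)
open import Data.Fin.Subset using (Subset; _∈_; ∣_∣)
open import Data.Bool using (Bool; true; false; not; _xor_)
open import Data.Product using (Σ; _×_; _,_; ∃-syntax)
open import Relation.Binary.PropositionalEquality using (_≡_; _≢_)
open import Relation.Nullary using (¬_)

-- An edge of K_n on vertex set Fin n: an unordered pair {i,j}, encoded
-- uniquely as an ordered pair (i , j) with i < j.
Edge : ℕ → Set
Edge n = Σ (Fin n × Fin n) (λ { (i , j) → i < j })

Graph : ℕ → Set
Graph n = Edge n → Bool

_≈G_ : {n : ℕ} → Graph n → Graph n → Set
G ≈G H = ∀ e → G e ≡ H e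

_△_ : {n : ℕ} → Graph n → Graph n → Graph n
(G △ H) e = G e xor H e

-- Agreement (G ∩ H) ∪ (complement G ∩ complement H): edges where G and H agree.
agreement : {n : ℕ} → Graph n → Graph n → Graph n
agreement G H e = not (G e xor H e)

HasTriangle : {n : ℕ} → Graph n → Set
HasTriangle {n} G =
  ∃[ a ] ∃[ b ] ∃[ c ] Σ (a < b) λ ab → Σ (b < c) λ bc → Σ (a < c) λ ac →
    (G ((a , b) , ab) ≡ true) × (G ((b , c) , bc) ≡ true) × (G ((a , c) , ac) ≡ true)

TriangleFree : {n : ℕ} → Graph n → Set
TriangleFree G = ¬ HasTriangle G

-- An indexed family of subgraphs with pairwise distinct members,
-- i.e. a set of k subgraphs.
Distinct : {n k : ℕ} → (Fin k → Graph n) → Set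
Distinct {k = k} F = (i j : Fin k) → i ≢ j → ¬ (F i ≈G F j)

-- V = {V i : i : Fin (2^m)} (a set of size 2^m) is useful for triangles:
-- every subset S ⊆ V of size 2^(m-3)+1 contains two distinct vectors
-- whose agreement is triangle-free.
UsefulForTriangles : {n : ℕ} (m : ℕ) → (Fin (2 ^ m) → Graph n) → Set
UsefulForTriangles m V =
  Distinct V ×
  ((S : Subset (2 ^ m)) → ∣ S ∣ ≡ 2 ^ (m ∸ 3) + 1 →
     ∃[ i ] ∃[ j ] (i ∈ S × j ∈ S × i ≢ j × TriangleFree (agreement (V i) (V j))))

TriangleAgreeing : {n k : ℕ} → (Fin k → Graph n) → Set
TriangleAgreeing {k = k} F =
  Distinct F × ((i j : Fin k) → i ≢ j → HasTriangle (agreement (F i) (F j)))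

-- Add every graph F f of the triangle-agreeing family to every vector V i of the useful set.
-- If F f △ V i = F f′ △ V j with i ≠ j then agreement (F f) (F f′) = agreement (V i) (V j),
-- so this agreement has a triangle; by usefulness a fixed graph therefore arises as such a
-- sum from at most 2^(m-3) of the V i. As f ↦ F f △ V i is injective for each i, double
-- counting the k · 2^m sums gives k · 2^m ≤ 2^(n C 2) · 2^(m-3).
module Submission where

open import Defs
open import Data.Nat using (ℕ; _≤_; _^_; _∸_)
open import Data.Nat.Combinatorics using (_C_)
open import Data.Fin using (Fin)
open import Data.Product using (∃-syntax; _×_)

open import Data.Bool using (true; false; not; _xor_)
open import Data.Bool.Properties using (xor-assoc; xor-comm; xor-same; T-≡)
open import Data.Nat using (zero; suc; _+_; _*_; z≤n; s≤s)
open import Data.Nat.Properties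
  using (_≤?_; ≰⇒>; +-comm; *-assoc; *-comm; *-cancelʳ-≤; ^-distribˡ-+-*;
         ^-monoʳ-≤; m^n≢0; m≤n+m∸n; m+[n∸m]≡n; ≤-trans)
open import Data.Nat.Combinatorics using (nC1≡n; nCk+nC[k+1]≡[n+1]C[k+1])
open import Data.Fin as Fin using (combine; remQuot; inject≤; funToFin; finToFun)
open import Data.Fin.Properties
  using (_≟_; any?; 2↔Bool; combine-injective; combine-remQuot; finToFun-funToFin;
         inject≤-injective; injective⇒≤; suc-injective)
open import Data.Fin.Subset using (Subset; _∈_; _⊆_; ∣_∣; ⊥)
open import Data.Fin.Subset.Properties using (⊆-min; ∣⊥∣≡0)
open import Data.Product using (_,_; proj₁; proj₂; uncurry)
open import Data.Vec using (Vec; []; _∷_; map; _++_; allFin; tabulate; lookup; here; there)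
open import Data.Vec.Properties using ([]=⇒lookup; lookup⇒[]=; lookup∘tabulate)
import Data.Vec.Membership.Propositional as Vec
open import Data.Vec.Membership.Propositional.Properties
  using (∈-map⁺; ∈-++⁺ˡ; ∈-++⁺ʳ; ∈-allFin⁺)
import Data.Vec.Relation.Unary.Any as Any
open import Data.Vec.Relation.Unary.Any.Properties using (lookup-index)
open import Function using (Injective; Inverse; _∘_; Equivalence)
open import Relation.Binary.PropositionalEquality
open import Relation.Nullary using (Dec; yes; no; contradiction)
open import Relation.Nullary.Decidable using (isYes; toWitness; fromWitness)

xor-involutiveˡ : ∀ x y → x xor (x xor y) ≡ y
xor-involutiveˡ x y = trans (sym (xor-assoc x x y)) (cong (_xor y) (xor-same x))

xor-cancelˡ : ∀ x y z → x xor y ≡ x xor z → y ≡ z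
xor-cancelˡ x y z e = begin
  y                  ≡⟨ xor-involutiveˡ x y ⟨
  x xor (x xor y)    ≡⟨ cong (x xor_) e ⟩
  x xor (x xor z)    ≡⟨ xor-involutiveˡ x z ⟩
  z                  ∎
  where open ≡-Reasoning

xor-exchange : ∀ a b c d → a xor b ≡ c xor d → a xor c ≡ b xor d
xor-exchange a b c d e = xor-cancelˡ a (a xor c) (b xor d) (begin
  a xor (a xor c)    ≡⟨ xor-involutiveˡ a c ⟩
  c                  ≡⟨ xor-involutiveˡ d c ⟨
  d xor (d xor c)    ≡⟨ cong (d xor_) (xor-comm d c) ⟩
  d xor (c xor d)    ≡⟨ cong (d xor_) e ⟨
  d xor (a xor b)    ≡⟨ xor-comm d (a xor b) ⟩
  (a xor b) xor d    ≡⟨ xor-assoc a b d ⟩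
  a xor (b xor d)    ∎)
  where open ≡-Reasoning

module _ {n : ℕ} where

  △-cancelʳ : {G G′ H : Graph n} → (G △ H) ≈G (G′ △ H) → G ≈G G′
  △-cancelʳ {G} {G′} {H} eq e = xor-cancelˡ (H e) (G e) (G′ e)
    (trans (xor-comm (H e) (G e)) (trans (eq e) (xor-comm (G′ e) (H e))))

  △-cancelˡ : {G H H′ : Graph n} → (G △ H) ≈G (G △ H′) → H ≈G H′
  △-cancelˡ {G} eq e = xor-cancelˡ (G e) _ _ (eq e)

  △-≈⇒agreement-≈ : {A B C D : Graph n} → (A △ B) ≈G (C △ D) → agreement A C ≈G agreement B D
  △-≈⇒agreement-≈ {A} {B} {C} {D} eq e =
    cong not (xor-exchange (A e) (B e) (C e) (D e) (eq e))

  HasTriangle-resp-≈G : {G H : Graph n} → G ≈G H → HasTriangle G → HasTriangle H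
  HasTriangle-resp-≈G {G} {H} eq (a , b , c , ab , bc , ac , Gab , Gbc , Gac) =
    a , b , c , ab , bc , ac , ≈-true Gab , ≈-true Gbc , ≈-true Gac
    where
    ≈-true : ∀ {e} → G e ≡ true → H e ≡ true
    ≈-true {e} = trans (sym (eq e))

Distinct⇒injective : ∀ {n k} {F : Fin k → Graph n} → Distinct F →
                     ∀ {i j} → F i ≈G F j → i ≡ j
Distinct⇒injective F-distinct {i} {j} eq with i ≟ j
... | yes i≡j = i≡j
... | no  i≢j = contradiction eq (F-distinct i j i≢j)

edgeCount : ℕ → ℕ
edgeCount zero    = 0
edgeCount (suc n) = n + edgeCount n

edgeCount≡nC2 : ∀ n → edgeCount n ≡ n C 2
edgeCount≡nC2 zero    = refl
edgeCount≡nC2 (suc n) =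
  trans (cong₂ _+_ (sym (nC1≡n n)) (edgeCount≡nC2 n)) (nCk+nC[k+1]≡[n+1]C[k+1] n 1)

edges : (n : ℕ) → Vec (Edge n) (edgeCount n)
edges zero    = []
edges (suc n) = map fromZero (allFin n) ++ map shift (edges n)
  where
  fromZero : Fin n → Edge (suc n)
  fromZero j = (Fin.zero , Fin.suc j) , s≤s z≤n
  shift : Edge n → Edge (suc n)
  shift ((i , j) , i<j) = (Fin.suc i , Fin.suc j) , s≤s i<j

∈-edges : ∀ n (e : Edge n) → e Vec.∈ edges n
∈-edges (suc n) ((Fin.zero  , Fin.suc j) , s≤s z≤n) = ∈-++⁺ˡ (∈-map⁺ _ (∈-allFin⁺ j))
∈-edges (suc n) ((Fin.suc i , Fin.suc j) , s≤s i<j) =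
  ∈-++⁺ʳ _ (∈-map⁺ _ (∈-edges n ((i , j) , i<j)))

encode : ∀ {n} → Graph n → Fin (2 ^ edgeCount n)
encode {n} G = funToFin (Inverse.from 2↔Bool ∘ G ∘ lookup (edges n))

funToFin-injective : ∀ {m n} {f g : Fin m → Fin n} → funToFin f ≡ funToFin g → f ≗ g
funToFin-injective {f = f} {g} eq x = begin
  f x                     ≡⟨ finToFun-funToFin f x ⟨
  finToFun (funToFin f) x ≡⟨ cong (λ c → finToFun c x) eq ⟩
  finToFun (funToFin g) x ≡⟨ finToFun-funToFin g x ⟩
  g x                     ∎
  where open ≡-Reasoning

encode-injective : ∀ {n} {G H : Graph n} → encode G ≡ encode H → G ≈G H
encode-injective {n} {G} {H} eq e = begin
  G e                  ≡⟨ cong G e≡e′ ⟩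
  G e′                 ≡⟨ strictlyInverseˡ (G e′) ⟨
  to (from (G e′))     ≡⟨ cong to (funToFin-injective eq x) ⟩
  to (from (H e′))     ≡⟨ strictlyInverseˡ (H e′) ⟩
  H e′                 ≡⟨ cong H e≡e′ ⟨
  H e                  ∎
  where
  open ≡-Reasoning
  open Inverse 2↔Bool using (to; from; strictlyInverseˡ)
  x = Any.index (∈-edges n e)
  e′ = lookup (edges n) x
  e≡e′ : e ≡ e′
  e≡e′ = lookup-index (∈-edges n e)

⊆-ofSize : ∀ {N} (S : Subset N) s → s ≤ ∣ S ∣ → ∃[ T ] (T ⊆ S × ∣ T ∣ ≡ s)
⊆-ofSize {N} S     zero    _  = ⊥ , ⊆-min S , ∣⊥∣≡0 N
⊆-ofSize (true ∷ S)  (suc s) (s≤s s≤∣S∣) with T , T⊆S , ∣T∣≡s ← ⊆-ofSize S s s≤∣S∣ =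
  true ∷ T , (λ { here → here ; (there x∈T) → there (T⊆S x∈T) }) , cong suc ∣T∣≡s
⊆-ofSize (false ∷ S) (suc s) s≤∣S∣ with T , T⊆S , ∣T∣≡s ← ⊆-ofSize S (suc s) s≤∣S∣ =
  false ∷ T , (λ { (there x∈T) → there (T⊆S x∈T) }) , ∣T∣≡s

rank : ∀ {N} (S : Subset N) {i} → i ∈ S → Fin ∣ S ∣
rank (true ∷ S)  here        = Fin.zero
rank (true ∷ S)  (there i∈S) = Fin.suc (rank S i∈S)
rank (false ∷ S) (there i∈S) = rank S i∈S

rank-injective : ∀ {N} (S : Subset N) {i j} (i∈S : i ∈ S) (j∈S : j ∈ S) →
                 rank S i∈S ≡ rank S j∈S → i ≡ j
rank-injective (true ∷ S)  here        here        _  = refl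
rank-injective (true ∷ S)  (there i∈S) (there j∈S) eq =
  cong Fin.suc (rank-injective S i∈S j∈S (suc-injective eq))
rank-injective (false ∷ S) (there i∈S) (there j∈S) eq =
  cong Fin.suc (rank-injective S i∈S j∈S eq)

injective-×⇒*-≤ : ∀ {a b c d} (φ : Fin a × Fin b → Fin c × Fin d) → Injective _≡_ _≡_ φ →
                  a * b ≤ c * d
injective-×⇒*-≤ {a} {b} {c} {d} φ φ-injective = injective⇒≤ ψ-injective
  where
  ψ : Fin (a * b) → Fin (c * d)
  ψ = uncurry combine ∘ φ ∘ remQuot {a} b
  ψ-injective : Injective _≡_ _≡_ ψ
  ψ-injective {x} {y} eq = begin
    x                                   ≡⟨ combine-remQuot {a} b x ⟨
    uncurry combine (remQuot {a} b x)   ≡⟨ cong (uncurry combine) (φ-injective φ-eq) ⟩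
    uncurry combine (remQuot {a} b y)   ≡⟨ combine-remQuot {a} b y ⟩
    y                                   ∎
    where
    open ≡-Reasoning
    φ-eq : φ (remQuot {a} b x) ≡ φ (remQuot {a} b y)
    φ-eq = uncurry (cong₂ _,_) (combine-injective _ _ _ _ eq)

-- p f i determines f for fixed i, so (f , i) is recovered from the value p f i together
-- with the rank of i among the (at most t) columns in which that value occurs.
module _ {k M N t : ℕ} (p : Fin k → Fin M → Fin N)
         (p-injectiveˡ : ∀ {f f′ i} → p f i ≡ p f′ i → f ≡ f′)
         (hitters-bounded : ∀ c (T : Subset M) → (∀ {i} → i ∈ T → ∃[ f ] p f i ≡ c) →
                            ∣ T ∣ ≤ t)
  where

  private
    Hits : Fin N → Fin M → Set
    Hits c i = ∃[ f ] p f i ≡ c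

    hits? : ∀ c i → Dec (Hits c i)
    hits? c i = any? (λ f → p f i ≟ c)

    hitters : Fin N → Subset M
    hitters c = tabulate (isYes ∘ hits? c)

    ∈-hitters⁻ : ∀ {c i} → i ∈ hitters c → Hits c i
    ∈-hitters⁻ {c} {i} i∈ = toWitness {a? = hits? c i} (Equivalence.from T-≡
      (trans (sym (lookup∘tabulate (isYes ∘ hits? c) i)) ([]=⇒lookup i∈)))

    ∈-hitters⁺ : ∀ f i → i ∈ hitters (p f i)
    ∈-hitters⁺ f i = lookup⇒[]= i _
      (trans (lookup∘tabulate _ i)
             (Equivalence.to T-≡ (fromWitness {a? = hits? (p f i) i} (f , refl))))

    slot : ∀ c {i} → i ∈ hitters c → Fin t
    slot c i∈ = inject≤ (rank (hitters c) i∈) (hitters-bounded c (hitters c) ∈-hitters⁻)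

    slot-injective : ∀ {c c′ i i′} → c ≡ c′ → (i∈ : i ∈ hitters c) (i′∈ : i′ ∈ hitters c′) →
                     slot c i∈ ≡ slot c′ i′∈ → i ≡ i′
    slot-injective refl i∈ i′∈ eq = rank-injective _ i∈ i′∈ (inject≤-injective _ _ _ _ eq)

    φ : Fin k × Fin M → Fin N × Fin t
    φ (f , i) = p f i , slot (p f i) (∈-hitters⁺ f i)

    φ-injective : Injective _≡_ _≡_ φ
    φ-injective {f , i} {f′ , i′} eq
      with refl ← slot-injective (cong proj₁ eq) _ _ (cong proj₂ eq) =
      cong (_, i) (p-injectiveˡ (cong proj₁ eq))

  double-counting : k * M ≤ N * t
  double-counting = injective-×⇒*-≤ φ φ-injective

m*2^[3+j]≤2^n*2^j⇒m≤2^[n∸3] : ∀ m n j → m * 2 ^ (3 + j) ≤ 2 ^ n * 2 ^ j → m ≤ 2 ^ (n ∸ 3)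
m*2^[3+j]≤2^n*2^j⇒m≤2^[n∸3] m n j le =
  *-cancelʳ-≤ m (2 ^ (n ∸ 3)) 8 (≤-trans {m * 8} m*8≤2^n 2^n≤2^[n∸3]*8)
  where
  m*8≤2^n : m * 8 ≤ 2 ^ n
  m*8≤2^n = *-cancelʳ-≤ (m * 8) (2 ^ n) (2 ^ j) {{m^n≢0 2 j}}
    (subst (_≤ 2 ^ n * 2 ^ j)
           (trans (cong (m *_) (^-distribˡ-+-* 2 3 j)) (sym (*-assoc m 8 (2 ^ j)))) le)
  2^n≤2^[n∸3]*8 : 2 ^ n ≤ 2 ^ (n ∸ 3) * 8
  2^n≤2^[n∸3]*8 = subst (2 ^ n ≤_) (trans (^-distribˡ-+-* 2 3 (n ∸ 3)) (*-comm 8 (2 ^ (n ∸ 3))))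
                        (^-monoʳ-≤ 2 (m≤n+m∸n n 3))

collision⇒HasTriangle : ∀ {n k M} {F : Fin k → Graph n} {V : Fin M → Graph n} →
  TriangleAgreeing F → Distinct V → ∀ {f f′ i j} → i ≢ j →
  (F f △ V i) ≈G (F f′ △ V j) → HasTriangle (agreement (V i) (V j))
collision⇒HasTriangle {F = F} {V} (_ , F-agreeing) V-distinct {f} {f′} {i} {j} i≢j eq
  with f ≟ f′
... | yes refl = contradiction (△-cancelˡ {G = F f} eq) (V-distinct i j i≢j)
... | no f≢f′  = HasTriangle-resp-≈G (△-≈⇒agreement-≈ {A = F f} {V i} {F f′} {V j} eq)
                                    (F-agreeing f f′ f≢f′)

sumCode : ∀ {n k M} → (Fin k → Graph n) → (Fin M → Graph n) →
          Fin k → Fin M → Fin (2 ^ edgeCount n)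
sumCode F V f i = encode (F f △ V i)

sumCode-injectiveˡ : ∀ {n k M} {F : Fin k → Graph n} {V : Fin M → Graph n} → Distinct F →
                     ∀ {f f′ i} → sumCode F V f i ≡ sumCode F V f′ i → f ≡ f′
sumCode-injectiveˡ {V = V} F-distinct {i = i} eq =
  Distinct⇒injective F-distinct (△-cancelʳ {H = V i} (encode-injective eq))

sumCode-fibre-bounded : ∀ {n k m} {F : Fin k → Graph n} {V : Fin (2 ^ m) → Graph n} →
  UsefulForTriangles m V → TriangleAgreeing F →
  ∀ c (T : Subset (2 ^ m)) → (∀ {i} → i ∈ T → ∃[ f ] sumCode F V f i ≡ c) →
  ∣ T ∣ ≤ 2 ^ (m ∸ 3)
sumCode-fibre-bounded {m = m} (V-distinct , V-useful) F-agreeing c T hits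
  with ∣ T ∣ ≤? 2 ^ (m ∸ 3)
... | yes ∣T∣≤ = ∣T∣≤
... | no ∣T∣≰
  with T′ , T′⊆T , ∣T′∣≡ ←
         ⊆-ofSize T (2 ^ (m ∸ 3) + 1) (subst (_≤ ∣ T ∣) (+-comm 1 _) (≰⇒> ∣T∣≰))
  with i , j , i∈T′ , j∈T′ , i≢j , triangle-free ← V-useful T′ ∣T′∣≡
  with f , fi≡c ← hits (T′⊆T i∈T′) | f′ , f′j≡c ← hits (T′⊆T j∈T′)
  = contradiction (collision⇒HasTriangle F-agreeing V-distinct {f} {f′} i≢j
                     (encode-injective (trans fi≡c (sym f′j≡c)))) triangle-free

proposition2 : (n : ℕ) → 1 ≤ n →
    (∃[ m ] (3 ≤ m × ∃[ V ] UsefulForTriangles {n} m V)) →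
    (k : ℕ) (F : Fin k → Graph n) → TriangleAgreeing F →
    k ≤ 2 ^ ((n C 2) ∸ 3)
proposition2 n _ (m , 3≤m , V , V-useful) k F F-agreeing =
  subst (λ L → k ≤ 2 ^ (L ∸ 3)) (edgeCount≡nC2 n)
    (m*2^[3+j]≤2^n*2^j⇒m≤2^[n∸3] k (edgeCount n) (m ∸ 3) k*2^m≤2^L*2^[m∸3])
  where
  k*2^m≤2^L*2^[m∸3] : k * 2 ^ (3 + (m ∸ 3)) ≤ 2 ^ edgeCount n * 2 ^ (m ∸ 3)
  k*2^m≤2^L*2^[m∸3] =
    subst (λ e → k * 2 ^ e ≤ 2 ^ edgeCount n * 2 ^ (m ∸ 3)) (sym (m+[n∸m]≡n 3≤m))
    (double-counting (sumCode F V) (sumCode-injectiveˡ {V = V} (proj₁ F-agreeing))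
                     (sumCode-fibre-bounded {m = m} {F = F} V-useful F-agreeing))
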